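{- Let $s = f_1 f_2\cdots f_z$ be the greedy nonclassical LZ77 parsing of a string $s$. Then the strings $f_i\cdot f_{i+1}[1]$, for $i\in\{1,\ldots,z-1\}$, are pairwise distinct (here $f_{i+1}[1]$ is the first letter of $f_{i+1}$ and $\cdot$ denotes concatenation).
   Context: A nonclassical LZ77 parsing of a string $s$ is a factorization $s=f_1f_2\cdots f_z$ into non-empty phrases such that each $f_i$ is either a single letter or a string that has an earlier occurrence in $s$, i.e., an occurrence starting at some position $j\le |f_1\cdots f_{i-1}|$ (possibly overlapping $f_i$). The greedy nonclassical LZ77 parsing is built from left to right by choosing each phrase as the longest string starting at the current position that is either a single letter or has such an earlier occurrence. -}

module Defs where

open import Level using (Level)
open import Data.Nat using (ℕ; zero; suc; _<_; _≤_)
open import Data.Fin using (Fin; fromℕ<)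
open import Data.List using (List; []; _∷_; _++_; length; drop; take; concat; lookup; [_])
open import Data.Product using (Σ; ∃; _×_)
open import Data.Sum using (_⊎_)
open import Relation.Binary.PropositionalEquality using (_≡_; _≢_)
open import Relation.Nullary using (¬_)
import Data.Fin
import Data.Nat.Properties

OccursAt : {a : Level} {A : Set a} → List A → ℕ → List A → Set _
OccursAt s j f = ∃ λ t → drop j s ≡ f ++ t

-- f is an admissible nonclassical LZ77 phrase of s starting at (0-based)
-- position k: f is non-empty, f occurs in s at position k, and f is either a
-- single letter or has an earlier occurrence, i.e. one starting at some
-- position j < k (possibly overlapping f).
IsPhrase : {a : Level} {A : Set a} → List A → ℕ → List A → Set _
IsPhrase s k f =
  ¬ (f ≡ []) × OccursAt s k f ×
  (length f ≡ 1 ⊎ Σ ℕ λ j → j < k × OccursAt s j f)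

startPos : {a : Level} {A : Set a} → List (List A) → ℕ → ℕ
startPos fs i = length (concat (take i fs))

IsGreedyLZ : {a : Level} {A : Set a} → List A → List (List A) → Set _
IsGreedyLZ s fs =
  concat fs ≡ s ×
  ((i : Fin (length fs)) →
     IsPhrase s (startPos fs (Data.Fin.toℕ i)) (lookup fs i) ×
     ((g : List _) → IsPhrase s (startPos fs (Data.Fin.toℕ i)) g →
        length g ≤ length (lookup fs i)))

-- The string f_i · f_{i+1}[1] (0-based i), defined when i + 1 < z.
-- The first letter of f_{i+1} is taken as  take 1 f_{i+1}.
extPhrase : {a : Level} {A : Set a} (fs : List (List A)) (i : ℕ) → suc i < length fs → List A
extPhrase fs i h =
  lookup fs (fromℕ< (Data.Nat.Properties.<-trans (Data.Nat.Properties.n<1+n i) h))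
  ++ take 1 (lookup fs (fromℕ< h))

module Submission where

-- The extended phrase f_j · f_{j+1}[1] occurs in s at the starting
-- position p_j of f_j and is one letter longer than f_j.  If it also occurred
-- at some earlier position, it would be an admissible phrase at p_j that is
-- longer than f_j, contradicting greediness.  Now if i < j and the extended
-- phrases of i and j coincide, then the one of j occurs at p_i < p_j (the
-- phrase f_i is non-empty), which is impossible.

open import Defs
open import Level using (Level)
open import Data.Nat using (ℕ; zero; suc; _<_; _≤_; _+_; z≤n; s≤s)
open import Data.Nat.Properties
  using (≤-refl; <-trans; <-cmp; n<1+n; +-comm; +-assoc; +-monoʳ-≤; m<m+n; 0≢1+n; <⇒≱; <-≤-trans)
open import Data.List using (List; []; _∷_; _++_; length; drop; take; concat; lookup)
open import Data.List.Properties using (length-++; take++drop≡id; ++-assoc)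
open import Data.Fin using (fromℕ<)
open import Data.Fin.Properties using (toℕ-fromℕ<)
open import Data.Product using (_,_; proj₁; proj₂)
open import Data.Sum using (inj₂)
open import Data.Empty using (⊥-elim)
open import Relation.Binary.PropositionalEquality
  using (_≡_; _≢_; refl; sym; trans; cong; subst; subst₂; module ≡-Reasoning)
open import Relation.Nullary using (¬_)
open import Relation.Binary.Definitions using (tri<; tri≈; tri>)

module _ {a : Level} {A : Set a} where

  phrase : (fs : List (List A)) (k : ℕ) → k < length fs → List A
  phrase fs k p = lookup fs (fromℕ< p)

  drop-length-++ : (xs ys : List A) → drop (length xs) (xs ++ ys) ≡ ys
  drop-length-++ []       ys = refl
  drop-length-++ (x ∷ xs) ys = drop-length-++ xs ys

  occursAt-after : (xs ys f t : List A) → ys ≡ f ++ t → OccursAt (xs ++ ys) (length xs) f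
  occursAt-after xs ys f t ys≡f++t = t , trans (drop-length-++ xs ys) ys≡f++t

  length-++-take1 : (f g : List A) → ¬ (g ≡ []) → length (f ++ take 1 g) ≡ suc (length f)
  length-++-take1 f []      g≢[] = ⊥-elim (g≢[] refl)
  length-++-take1 f (y ∷ g) _    = trans (length-++ f) (+-comm (length f) 1)

  concat-around-extPhrase : (fs : List (List A)) (k : ℕ) (q : suc k < length fs) →
    concat fs ≡ concat (take k fs) ++ (extPhrase fs k q ++ drop 1 (phrase fs (suc k) q) ++ concat (drop (suc (suc k)) fs))
  concat-around-extPhrase (f ∷ g ∷ rest) zero q = begin
      f ++ (g ++ concat rest)
        ≡⟨ cong (λ g′ → f ++ (g′ ++ concat rest)) (sym (take++drop≡id 1 g)) ⟩
      f ++ ((take 1 g ++ drop 1 g) ++ concat rest)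
        ≡⟨ cong (f ++_) (++-assoc (take 1 g) (drop 1 g) (concat rest)) ⟩
      f ++ (take 1 g ++ (drop 1 g ++ concat rest))
        ≡⟨ sym (++-assoc f (take 1 g) _) ⟩
      (f ++ take 1 g) ++ (drop 1 g ++ concat rest) ∎
    where open ≡-Reasoning
  concat-around-extPhrase (f ∷ fs) (suc k) (s≤s q) =
    trans (cong (f ++_) (concat-around-extPhrase fs k q)) (sym (++-assoc f (concat (take k fs)) _))

  extPhrase-occurs : (fs : List (List A)) (k : ℕ) (q : suc k < length fs) →
    OccursAt (concat fs) (startPos fs k) (extPhrase fs k q)
  extPhrase-occurs fs k q =
    subst (λ w → OccursAt w (startPos fs k) (extPhrase fs k q))
      (sym (concat-around-extPhrase fs k q))
      (occursAt-after (concat (take k fs)) _ (extPhrase fs k q) _ refl)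

  startPos-suc : (fs : List (List A)) (k : ℕ) (p : k < length fs) →
    startPos fs (suc k) ≡ startPos fs k + length (phrase fs k p)
  startPos-suc (f ∷ fs) zero    p       = trans (length-++ f) (+-comm (length f) 0)
  startPos-suc (f ∷ fs) (suc k) (s≤s p) = begin
      length (f ++ concat (take (suc k) fs))                ≡⟨ length-++ f ⟩
      length f + startPos fs (suc k)                         ≡⟨ cong (length f +_) (startPos-suc fs k p) ⟩
      length f + (startPos fs k + length (phrase fs k p))    ≡⟨ sym (+-assoc (length f) _ _) ⟩
      (length f + startPos fs k) + length (phrase fs k p)    ≡⟨ cong (_+ length (phrase fs k p)) (sym (length-++ f)) ⟩
      startPos (f ∷ fs) (suc k) + length (phrase fs k p)     ∎
    where open ≡-Reasoning

  startPos-mono : (fs : List (List A)) (m n : ℕ) → m ≤ n → startPos fs m ≤ startPos fs n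
  startPos-mono fs       zero    n       _         = z≤n
  startPos-mono []       (suc m) (suc n) _         = ≤-refl
  startPos-mono (f ∷ fs) (suc m) (suc n) (s≤s m≤n) =
    subst₂ _≤_ (sym (length-++ f)) (sym (length-++ f)) (+-monoʳ-≤ (length f) (startPos-mono fs m n m≤n))

  startPos-< : (fs : List (List A)) (i j : ℕ) (p : i < length fs) →
    ¬ (phrase fs i p ≡ []) → i < j → startPos fs i < startPos fs j
  startPos-< fs i j p fᵢ≢[] i<j = <-≤-trans
    (subst (startPos fs i <_) (sym (startPos-suc fs i p)) (m<m+n (startPos fs i) (nonempty⇒1≤ (phrase fs i p) fᵢ≢[])))
    (startPos-mono fs (suc i) j i<j)
    where
    nonempty⇒1≤ : (f : List A) → ¬ (f ≡ []) → 1 ≤ length f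
    nonempty⇒1≤ []      f≢[] = ⊥-elim (f≢[] refl)
    nonempty⇒1≤ (x ∷ f) _    = s≤s z≤n

  greedy-phrase : (s : List A) (fs : List (List A)) → IsGreedyLZ s fs →
    (k : ℕ) (p : k < length fs) → IsPhrase s (startPos fs k) (phrase fs k p)
  greedy-phrase s fs (_ , G) k p =
    subst (λ m → IsPhrase s (startPos fs m) (phrase fs k p)) (toℕ-fromℕ< p) (proj₁ (G (fromℕ< p)))

  greedy-longest : (s : List A) (fs : List (List A)) → IsGreedyLZ s fs →
    (k : ℕ) (p : k < length fs) (g : List A) → IsPhrase s (startPos fs k) g →
    length g ≤ length (phrase fs k p)
  greedy-longest s fs (_ , G) k p g g-admissible =
    proj₂ (G (fromℕ< p)) g (subst (λ m → IsPhrase s (startPos fs m) g) (sym (toℕ-fromℕ< p)) g-admissible)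

  -- Key lemma: the extended phrase f_j · f_{j+1}[1] has no occurrence in s
  -- before the starting position of f_j; otherwise it would be an admissible
  -- phrase there, longer than the greedy choice f_j.
  extPhrase-no-earlier-occurrence : (s : List A) (fs : List (List A)) → IsGreedyLZ s fs →
    (j : ℕ) (hj : suc j < length fs) (pos : ℕ) → pos < startPos fs j →
    ¬ OccursAt s pos (extPhrase fs j hj)
  extPhrase-no-earlier-occurrence s fs G j hj pos pos<pⱼ occ =
    <⇒≱ (subst (length fⱼ <_) (sym length-ext) (n<1+n (length fⱼ)))
        (greedy-longest s fs G j pj ext ext-admissible)
    where
    pj = <-trans (n<1+n j) hj
    fⱼ = phrase fs j pj
    ext = extPhrase fs j hj
    length-ext : length ext ≡ suc (length fⱼ)
    length-ext = length-++-take1 fⱼ (phrase fs (suc j) hj) (proj₁ (greedy-phrase s fs G (suc j) hj))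
    ext-admissible : IsPhrase s (startPos fs j) ext
    ext-admissible =
        (λ ext≡[] → 0≢1+n (trans (sym (cong length ext≡[])) length-ext))
      , subst (λ w → OccursAt w (startPos fs j) ext) (proj₁ G) (extPhrase-occurs fs j hj)
      , inj₂ (pos , pos<pⱼ , occ)

  -- For i < j the extended phrases differ: equality would place the j-th
  -- one at the starting position of f_i, which lies before that of f_j.
  extPhrase-distinct-< : (s : List A) (fs : List (List A)) → IsGreedyLZ s fs →
    (i j : ℕ) (hi : suc i < length fs) (hj : suc j < length fs) →
    i < j → extPhrase fs i hi ≢ extPhrase fs j hj
  extPhrase-distinct-< s fs G i j hi hj i<j extᵢ≡extⱼ =
    extPhrase-no-earlier-occurrence s fs G j hj (startPos fs i)
      (startPos-< fs i j pi (proj₁ (greedy-phrase s fs G i pi)) i<j)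
      (subst₂ (λ w e → OccursAt w (startPos fs i) e) (proj₁ G) extᵢ≡extⱼ (extPhrase-occurs fs i hi))
    where
    pi = <-trans (n<1+n i) hi

lemma7 : {a : Level} {A : Set a} (s : List A) (fs : List (List A)) →
    IsGreedyLZ s fs →
    (i j : ℕ) (hi : suc i < length fs) (hj : suc j < length fs) →
    i ≢ j → extPhrase fs i hi ≢ extPhrase fs j hj
lemma7 s fs G i j hi hj i≢j extᵢ≡extⱼ with <-cmp i j
... | tri< i<j _ _ = extPhrase-distinct-< s fs G i j hi hj i<j extᵢ≡extⱼ
... | tri≈ _ i≡j _ = i≢j i≡j
... | tri> _ _ j<i = extPhrase-distinct-< s fs G j i hj hi j<i (sym extᵢ≡extⱼ)
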